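{- Let $v\geq 1$ and, for $i=1,\dots,v$, let $A_i=\begin{bmatrix}0&\epsilon_i\\ 1&\alpha_i\end{bmatrix}$ with $\epsilon_i\in\{ -1,1\}$, $\alpha_i\in\mathbb{Z}$. Let $P_1,P_2$ be finite products of matrices from $\{A_1,\dots,A_v\}$ (repetitions allowed), $P_i=\begin{bmatrix}a_i&b_i\\ c_i&d_i\end{bmatrix}$, with $|d_i|\ge2$, $b_i\ne0$, $c_i\ne0$ and $0\le\frac{|a_i|}{|b_i|},\frac{|c_i|}{|d_i|},\frac{|a_i|}{|c_i|},\frac{|b_i|}{|d_i|}\le1$ for $i=1,2$. Let $(q_m)_{m\ge1}$ be positive integers and define $P_{m+2}=P_{m+1}^{q_m}P_m=\begin{bmatrix}a_{m+2}&b_{m+2}\\ c_{m+2}&d_{m+2}\end{bmatrix}$ for $m\ge1$. Then $$\lim_{m\to\infty}|a_m|=\lim_{m\to\infty}|b_m|=\lim_{m\to\infty}|c_m|=\lim_{m\to\infty}|d_m|=\infty.$$ -}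

module Defs where

open import Data.Nat using (ℕ; zero; suc)
open import Data.Integer using (ℤ; _+_; _*_; 0ℤ; 1ℤ)
open import Data.Fin using (Fin)
open import Data.List using (List; []; _∷_)

record Mat2 : Set where
  constructor mat
  field
    a b c d : ℤ
open Mat2 public

_⊗_ : Mat2 → Mat2 → Mat2
mat a₁ b₁ c₁ d₁ ⊗ mat a₂ b₂ c₂ d₂ =
  mat (a₁ * a₂ + b₁ * c₂) (a₁ * b₂ + b₁ * d₂)
      (c₁ * a₂ + d₁ * c₂) (c₁ * b₂ + d₁ * d₂)

I₂ : Mat2
I₂ = mat 1ℤ 0ℤ 0ℤ 1ℤ

_^ᴹ_ : Mat2 → ℕ → Mat2
M ^ᴹ zero = I₂
M ^ᴹ suc n = M ⊗ (M ^ᴹ n)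

Amat : ℤ → ℤ → Mat2
Amat ε α = mat 0ℤ ε 1ℤ α

prodA : ∀ {v} → (Fin v → ℤ) → (Fin v → ℤ) → List (Fin v) → Mat2
prodA ε α [] = I₂
prodA ε α (i ∷ w) = Amat (ε i) (α i) ⊗ prodA ε α w

-- The sequence P_m (1-indexed; index 0 is an unused dummy):
-- P_1 = P1, P_2 = P2, P_{m+2} = P_{m+1}^{q_m} P_m for m ≥ 1.
Pseq : Mat2 → Mat2 → (ℕ → ℕ) → ℕ → Mat2
Pseq P1 P2 q zero = I₂
Pseq P1 P2 q (suc zero) = P1
Pseq P1 P2 q (suc (suc zero)) = P2
Pseq P1 P2 q (suc (suc (suc m))) =
  (Pseq P1 P2 q (suc (suc m)) ^ᴹ q (suc m)) ⊗ Pseq P1 P2 q (suc m)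

-- Conjugating by a rotation by 45° turns the conditions |a| ≤ |b|, |c| ≤ |d|, |a| ≤ |c|,
-- |b| ≤ |d| into sign conditions on the rotated rows and columns, and det = ±1 together with
-- |b|, |c| < |d| makes the rotated matrix rot M sign-definite. Sign-definiteness is preserved by
-- products, so every P_m satisfies all the hypotheses on P_1 and P_2. For such matrices |d| grows
-- under products, |b| and |d| − |c| under left multiplication (|b| strictly once |b| ≥ 2) and |c|
-- under right multiplication. Along P_{m+2} = P_{m+1}^{q_m} P_m this yields |b|, |c| ≥ 2 after a
-- few steps, then |b| → ∞, and |a (X P)| ≥ |b X| when |c P| ≥ 2 gives |a| → ∞; the other entries
-- dominate |a|.

module Submission where

open import Defs
open import Data.Fin.Base using (Fin)
open import Data.Integer.Base as ℤ
  using (ℤ; +_; -[1+_]; _+_; _*_; -_; _-_; ∣_∣; 0ℤ; 1ℤ; -1ℤ; +≤+)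
import Data.Integer.Properties as ℤ
open import Data.Integer.Tactic.RingSolver using (solve-∀)
open import Data.List.Base using ([]; _∷_)
open import Data.Nat.Base as ℕ using (ℕ; zero; suc; z≤n; s≤s; _≤_; _<_)
import Data.Nat.Properties as ℕ
import Data.Nat.Tactic.RingSolver as ℕ-Solver
open import Data.Product.Base using (∃; ∃-syntax; _×_; _,_; proj₁)
open import Data.Sum.Base using (_⊎_; inj₁; inj₂)
open import Relation.Binary.PropositionalEquality

variable
  s t x y z u v p r w : ℤ
  P Q : Mat2

IsUnit : ℤ → Set
IsUnit s = s ≡ 1ℤ ⊎ s ≡ -1ℤ

isUnit-* : IsUnit s → IsUnit t → IsUnit (s * t)
isUnit-* (inj₁ refl) (inj₁ refl) = inj₁ refl
isUnit-* (inj₁ refl) (inj₂ refl) = inj₂ refl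
isUnit-* (inj₂ refl) (inj₁ refl) = inj₂ refl
isUnit-* (inj₂ refl) (inj₂ refl) = inj₁ refl

isUnit-neg : IsUnit s → IsUnit (- s)
isUnit-neg (inj₁ refl) = inj₂ refl
isUnit-neg (inj₂ refl) = inj₁ refl

isUnit⇒s*s≡1 : IsUnit s → s * s ≡ 1ℤ
isUnit⇒s*s≡1 (inj₁ refl) = refl
isUnit⇒s*s≡1 (inj₂ refl) = refl

isUnit⇒∣s∣≡1 : IsUnit s → ∣ s ∣ ≡ 1
isUnit⇒∣s∣≡1 (inj₁ refl) = refl
isUnit⇒∣s∣≡1 (inj₂ refl) = refl

∣unit*x∣≡∣x∣ : IsUnit s → ∀ x → ∣ s * x ∣ ≡ ∣ x ∣
∣unit*x∣≡∣x∣ {s} hs x = begin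
  ∣ s * x ∣         ≡⟨ ℤ.abs-* s x ⟩
  ∣ s ∣ ℕ.* ∣ x ∣   ≡⟨ cong (ℕ._* ∣ x ∣) (isUnit⇒∣s∣≡1 hs) ⟩
  1 ℕ.* ∣ x ∣       ≡⟨ ℕ.*-identityˡ ∣ x ∣ ⟩
  ∣ x ∣             ∎
  where open ≡-Reasoning

isUnit-*⇒∣x∣≡1 : ∀ x y → IsUnit (x * y) → ∣ x ∣ ≡ 1
isUnit-*⇒∣x∣≡1 x y h =
  ℕ.m*n≡1⇒m≡1 ∣ x ∣ ∣ y ∣ (trans (sym (ℤ.abs-* x y)) (isUnit⇒∣s∣≡1 h))

unit-normalizer : ∀ x → ∃ λ s → IsUnit s × s * x ≡ + ∣ x ∣
unit-normalizer (+ n)    = 1ℤ , inj₁ refl , ℤ.*-identityˡ (+ n)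
unit-normalizer -[1+ n ] = -1ℤ , inj₂ refl , ℤ.-1*i≡-i -[1+ n ]

*-distrib-normalized : s * y ≡ + ∣ y ∣ → ∀ w → s * (y + w) ≡ + ∣ y ∣ + s * w
*-distrib-normalized {s} {y} sy≡∣y∣ w = trans (ℤ.*-distribˡ-+ s y w) (cong (_+ s * w) sy≡∣y∣)

0≤2*z⇒0≤z : 0ℤ ℤ.≤ + 2 * z → 0ℤ ℤ.≤ z
0≤2*z⇒0≤z {+ n} _ = +≤+ z≤n

0≤i*j : 0ℤ ℤ.≤ x → 0ℤ ℤ.≤ y → 0ℤ ℤ.≤ x * y
0≤i*j {x} {y} 0≤x 0≤y =
  subst (ℤ._≤ x * y) (ℤ.*-zeroʳ x) (ℤ.*-monoˡ-≤-nonNeg x {{ℤ.nonNegative 0≤x}} 0≤y)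

0≤i+j : 0ℤ ℤ.≤ x → 0ℤ ℤ.≤ y → 0ℤ ℤ.≤ x + y
0≤i+j (+≤+ _) (+≤+ _) = +≤+ z≤n

∣i+j∣≡∣i∣+∣j∣ : 0ℤ ℤ.≤ x → 0ℤ ℤ.≤ y → ∣ x + y ∣ ≡ ∣ x ∣ ℕ.+ ∣ y ∣
∣i+j∣≡∣i∣+∣j∣ (+≤+ _) (+≤+ _) = refl

0≤+n+w : ∀ {n} → ∣ w ∣ ≤ n → 0ℤ ℤ.≤ + n + w
0≤+n+w {+ k}      _   = +≤+ z≤n
0≤+n+w { -[1+ k ]} k<n rewrite ℤ.⊖-≥ k<n = +≤+ z≤n

1≤+n+w : ∀ {n} → ∣ w ∣ < n → 1ℤ ℤ.≤ + n + w
1≤+n+w {+ k}       k<n = +≤+ (ℕ.≤-trans (ℕ.≤-trans (s≤s z≤n) k<n) (ℕ.m≤m+n _ k))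
1≤+n+w { -[1+ k ]} k<n rewrite ℤ.⊖-≥ (ℕ.<⇒≤ k<n) = +≤+ (ℕ.m+n≤o⇒m≤o∸n 1 k<n)

0≤n*z⇒0≤z : ∀ {n} → 1 ≤ n → 0ℤ ℤ.≤ + n * z → 0ℤ ℤ.≤ z
0≤n*z⇒0≤z {+ k}                _ _  = +≤+ z≤n
0≤n*z⇒0≤z { -[1+ k ]} {suc n} _ ()

0≤u*v+unit : 1ℤ ℤ.≤ u → 1ℤ ℤ.≤ v → IsUnit w → 0ℤ ℤ.≤ u * v + w
0≤u*v+unit (+≤+ (s≤s z≤n)) (+≤+ (s≤s z≤n)) (inj₁ refl) = +≤+ z≤n
0≤u*v+unit (+≤+ (s≤s z≤n)) (+≤+ (s≤s z≤n)) (inj₂ refl) = +≤+ z≤n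

∣y∣∸∣x∣≤∣y+x∣ : ∀ x y → ∣ y ∣ ℕ.∸ ∣ x ∣ ≤ ∣ y + x ∣
∣y∣∸∣x∣≤∣y+x∣ x y = ℕ.m≤n+o⇒m∸n≤o ∣ y ∣ ∣ x ∣ (begin
  ∣ y ∣                  ≡⟨ cong ∣_∣ (cancel x y) ⟩
  ∣ (y + x) - x ∣        ≤⟨ ℤ.∣i-j∣≤∣i∣+∣j∣ (y + x) x ⟩
  ∣ y + x ∣ ℕ.+ ∣ x ∣    ≡⟨ ℕ.+-comm ∣ y + x ∣ ∣ x ∣ ⟩
  ∣ x ∣ ℕ.+ ∣ y + x ∣    ∎)
  where
  open ℕ.≤-Reasoning
  cancel : ∀ x y → y ≡ (y + x) - x
  cancel = solve-∀

∣y∣∸∣x∣≤∣y-x∣ : ∀ x y → ∣ y ∣ ℕ.∸ ∣ x ∣ ≤ ∣ y - x ∣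
∣y∣∸∣x∣≤∣y-x∣ x y = subst (λ k → ∣ y ∣ ℕ.∸ k ≤ ∣ y - x ∣) (ℤ.∣-i∣≡∣i∣ x) (∣y∣∸∣x∣≤∣y+x∣ (- x) y)

∣r∣∣s∣∸∣p∣∣q∣≤∣pq+rs∣ : ∀ p q r s → ∣ r ∣ ℕ.* ∣ s ∣ ℕ.∸ ∣ p ∣ ℕ.* ∣ q ∣ ≤ ∣ p * q + r * s ∣
∣r∣∣s∣∸∣p∣∣q∣≤∣pq+rs∣ p q r s =
  subst₂ (λ m n → m ℕ.∸ n ≤ ∣ p * q + r * s ∣) (ℤ.abs-* r s) (ℤ.abs-* p q)
    (subst (λ k → ∣ r * s ∣ ℕ.∸ ∣ p * q ∣ ≤ ∣ k ∣) (ℤ.+-comm (r * s) (p * q))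
      (∣y∣∸∣x∣≤∣y+x∣ (p * q) (r * s)))

≤∧<⇒≤*∸* : ∀ {m n k l} → k ≤ m → l < n → m ≤ m ℕ.* n ℕ.∸ k ℕ.* l
≤∧<⇒≤*∸* {m} {n} {k} {l} k≤m l<n = ℕ.m+n≤o⇒m≤o∸n m (begin
  m ℕ.+ k ℕ.* l     ≤⟨ ℕ.+-monoʳ-≤ m (ℕ.*-monoˡ-≤ l k≤m) ⟩
  m ℕ.+ m ℕ.* l     ≡⟨ sym (ℕ.*-suc m l) ⟩
  m ℕ.* suc l       ≤⟨ ℕ.*-monoʳ-≤ m l<n ⟩
  m ℕ.* n           ∎)
  where open ℕ.≤-Reasoning

<∧<⇒+≤1+*∸* : ∀ {m n k l} → k < m → l < n → m ℕ.+ n ≤ suc (m ℕ.* n ℕ.∸ k ℕ.* l)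
<∧<⇒+≤1+*∸* {suc m} {suc n} {k} {l} (s≤s k≤m) (s≤s l≤n) =
  s≤s (ℕ.m+n≤o⇒m≤o∸n (m ℕ.+ suc n) (begin
    m ℕ.+ suc n ℕ.+ k ℕ.* l  ≤⟨ ℕ.+-monoʳ-≤ (m ℕ.+ suc n) (ℕ.*-mono-≤ k≤m l≤n) ⟩
    m ℕ.+ suc n ℕ.+ m ℕ.* n  ≡⟨ expand m n ⟩
    suc m ℕ.* suc n          ∎))
  where
  open ℕ.≤-Reasoning
  expand : ∀ m n → m ℕ.+ suc n ℕ.+ m ℕ.* n ≡ suc m ℕ.* suc n
  expand = ℕ-Solver.solve-∀

+≤1+⇒< : ∀ {m n k} → 2 ≤ m → m ℕ.+ n ≤ suc k → n < k
+≤1+⇒< {m} {n} 2≤m m+n≤1+k = ℕ.s≤s⁻¹ (ℕ.≤-trans (ℕ.+-monoˡ-≤ n 2≤m) m+n≤1+k)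

∣x∣≡∣y∣⇒y≡x⊎y≡-x : ∣ x ∣ ≡ ∣ y ∣ → y ≡ x ⊎ y ≡ - x
∣x∣≡∣y∣⇒y≡x⊎y≡-x {+ m}      {+ .m}           refl = inj₁ refl
∣x∣≡∣y∣⇒y≡x⊎y≡-x {+ .(suc n)} { -[1+ n ]}   refl = inj₂ refl
∣x∣≡∣y∣⇒y≡x⊎y≡-x { -[1+ m ]} {+ .(suc m)}    refl = inj₂ refl
∣x∣≡∣y∣⇒y≡x⊎y≡-x { -[1+ m ]} { -[1+ .m ]}   refl = inj₁ refl

∸≤⊓ : ∀ x y → ∣ y ∣ ℕ.∸ ∣ x ∣ ≤ ∣ y + x ∣ ℕ.⊓ ∣ y - x ∣
∸≤⊓ x y = ℕ.⊓-glb (∣y∣∸∣x∣≤∣y+x∣ x y) (∣y∣∸∣x∣≤∣y-x∣ x y)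

⊓≤∸ : ∀ x y → ∣ x ∣ ≤ ∣ y ∣ → ∣ y + x ∣ ℕ.⊓ ∣ y - x ∣ ≤ ∣ y ∣ ℕ.∸ ∣ x ∣
⊓≤∸ x y ∣x∣≤∣y∣ with unit-normalizer y
... | s , s-unit , sy≡∣y∣ = subst₂ (λ m k → m ≤ ∣ y ∣ ℕ.∸ k)
  (cong₂ ℕ._⊓_ (normalize x) (trans (cong (λ k → ∣ + ∣ y ∣ + k ∣) (ℤ.neg-distribʳ-* s x)) (normalize (- x))))
  (∣unit*x∣≡∣x∣ s-unit x)
  (shifted (s * x) (subst (_≤ ∣ y ∣) (sym (∣unit*x∣≡∣x∣ s-unit x)) ∣x∣≤∣y∣))
  where
  normalize : ∀ w → ∣ + ∣ y ∣ + s * w ∣ ≡ ∣ y + w ∣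
  normalize w = trans (cong ∣_∣ (sym (*-distrib-normalized {s} {y} sy≡∣y∣ w))) (∣unit*x∣≡∣x∣ s-unit (y + w))
  shifted : ∀ w → ∣ w ∣ ≤ ∣ y ∣ → ∣ + ∣ y ∣ + w ∣ ℕ.⊓ ∣ + ∣ y ∣ - w ∣ ≤ ∣ y ∣ ℕ.∸ ∣ w ∣
  shifted (+ k) k≤n = ℕ.≤-trans (ℕ.m⊓n≤n _ ∣ + ∣ y ∣ - + k ∣)
    (ℕ.≤-reflexive (trans (cong ∣_∣ (ℤ.[+m]-[+n]≡m⊖n ∣ y ∣ k)) (cong ∣_∣ (ℤ.⊖-≥ k≤n))))
  shifted -[1+ k ] k<n = ℕ.≤-trans (ℕ.m⊓n≤m ∣ + ∣ y ∣ + -[1+ k ] ∣ _)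
    (ℕ.≤-reflexive (cong ∣_∣ (ℤ.⊖-≥ k<n)))

1≤n⇒n≡1⊎2≤n : ∀ {n} → 1 ≤ n → n ≡ 1 ⊎ 2 ≤ n
1≤n⇒n≡1⊎2≤n {suc zero}    _ = inj₁ refl
1≤n⇒n≡1⊎2≤n {suc (suc n)} _ = inj₂ (s≤s (s≤s z≤n))

SameSign₂ : ℤ → ℤ → Set
SameSign₂ u v = ∃ λ s → IsUnit s × 0ℤ ℤ.≤ s * u × 0ℤ ℤ.≤ s * v

SameSign : Mat2 → Set
SameSign M = ∃ λ s → IsUnit s ×
  0ℤ ℤ.≤ s * a M × 0ℤ ℤ.≤ s * b M × 0ℤ ℤ.≤ s * c M × 0ℤ ℤ.≤ s * d M

-- R' M R with R = [[1,-1],[1,1]] and R' = [[1,1],[-1,1]]; since R R' = 2·I,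
-- 2·rot (P ⊗ Q) = rot P ⊗ rot Q, and x ≼ y says that (x , y) R is sign-definite.
rot : Mat2 → Mat2
rot M = mat (a M + b M + c M + d M) ((b M + d M) - (a M + c M))
            ((c M + d M) - (a M + b M)) ((a M + d M) - (b M + c M))

_≼_ : ℤ → ℤ → Set
x ≼ y = SameSign₂ (y + x) (y - x)

*-distrib-inner : ∀ s t u p v r → (s * t) * (u * p + v * r) ≡ (s * u) * (t * p) + (s * v) * (t * r)
*-distrib-inner = solve-∀

0≤half-inner : ∀ s t → + 2 * z ≡ u * p + v * r →
  0ℤ ℤ.≤ s * u → 0ℤ ℤ.≤ s * v → 0ℤ ℤ.≤ t * p → 0ℤ ℤ.≤ t * r → 0ℤ ℤ.≤ (s * t) * z
0≤half-inner {z} {u} {p} {v} {r} s t eq su sv tp tr =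
  0≤2*z⇒0≤z (subst (0ℤ ℤ.≤_) (sym twice) (0≤i+j (0≤i*j su tp) (0≤i*j sv tr)))
  where
  open ≡-Reasoning
  rearrange : ∀ s t z → + 2 * ((s * t) * z) ≡ (s * t) * (+ 2 * z)
  rearrange = solve-∀
  twice : + 2 * ((s * t) * z) ≡ (s * u) * (t * p) + (s * v) * (t * r)
  twice = begin
    + 2 * ((s * t) * z)               ≡⟨ rearrange s t z ⟩
    (s * t) * (+ 2 * z)               ≡⟨ cong ((s * t) *_) eq ⟩
    (s * t) * (u * p + v * r)         ≡⟨ *-distrib-inner s t u p v r ⟩
    (s * u) * (t * p) + (s * v) * (t * r) ∎

⊓≤∣half-inner∣ : ∀ s t → IsUnit s → IsUnit t → + 2 * z ≡ u * p + v * r →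
  0ℤ ℤ.≤ s * u → 0ℤ ℤ.≤ s * v → 0ℤ ℤ.≤ t * p → 0ℤ ℤ.≤ t * r → 2 ≤ ∣ p + r ∣ →
  ∣ u ∣ ℕ.⊓ ∣ v ∣ ≤ ∣ z ∣
⊓≤∣half-inner∣ {z} {u} {p} {v} {r} s t s-unit t-unit eq su sv tp tr 2≤∣p+r∣ = ℕ.*-cancelˡ-≤ 2 (begin
  2 ℕ.* μ                                          ≡⟨ ℕ.*-comm 2 μ ⟩
  μ ℕ.* 2                                          ≤⟨ ℕ.*-monoʳ-≤ μ (ℕ.≤-trans 2≤∣p+r∣ (ℤ.∣i+j∣≤∣i∣+∣j∣ p r)) ⟩
  μ ℕ.* (∣ p ∣ ℕ.+ ∣ r ∣)                          ≡⟨ ℕ.*-distribˡ-+ μ ∣ p ∣ ∣ r ∣ ⟩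
  μ ℕ.* ∣ p ∣ ℕ.+ μ ℕ.* ∣ r ∣                      ≤⟨ ℕ.+-mono-≤ (ℕ.*-monoˡ-≤ ∣ p ∣ (ℕ.m⊓n≤m ∣ u ∣ ∣ v ∣))
                                                                 (ℕ.*-monoˡ-≤ ∣ r ∣ (ℕ.m⊓n≤n ∣ u ∣ ∣ v ∣)) ⟩
  ∣ u ∣ ℕ.* ∣ p ∣ ℕ.+ ∣ v ∣ ℕ.* ∣ r ∣              ≡⟨ sym (cong₂ ℕ._+_ (∣su*tp∣ u p) (∣su*tp∣ v r)) ⟩
  ∣ (s * u) * (t * p) ∣ ℕ.+ ∣ (s * v) * (t * r) ∣  ≡⟨ sym (∣i+j∣≡∣i∣+∣j∣ (0≤i*j su tp) (0≤i*j sv tr)) ⟩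
  ∣ (s * u) * (t * p) + (s * v) * (t * r) ∣        ≡⟨ cong ∣_∣ (sym (*-distrib-inner s t u p v r)) ⟩
  ∣ (s * t) * (u * p + v * r) ∣                    ≡⟨ ∣unit*x∣≡∣x∣ (isUnit-* s-unit t-unit) (u * p + v * r) ⟩
  ∣ u * p + v * r ∣                                ≡⟨ cong ∣_∣ (sym eq) ⟩
  ∣ + 2 * z ∣                                      ≡⟨ ℤ.abs-* (+ 2) z ⟩
  2 ℕ.* ∣ z ∣                                      ∎)
  where
  open ℕ.≤-Reasoning
  μ = ∣ u ∣ ℕ.⊓ ∣ v ∣
  ∣su*tp∣ : ∀ u p → ∣ (s * u) * (t * p) ∣ ≡ ∣ u ∣ ℕ.* ∣ p ∣
  ∣su*tp∣ u p = trans (ℤ.abs-* (s * u) (t * p)) (cong₂ ℕ._*_ (∣unit*x∣≡∣x∣ s-unit u) (∣unit*x∣≡∣x∣ t-unit p))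

sameSign-rot-⊗ : ∀ P Q → SameSign (rot P) → SameSign (rot Q) → SameSign (rot (P ⊗ Q))
sameSign-rot-⊗ (mat a b c d) (mat e f g h) (s , s-unit , sp , sq , sr , ss) (t , t-unit , tp , tq , tr , ts) =
  s * t , isUnit-* s-unit t-unit ,
  0≤half-inner s t (entry₁₁ a b c d e f g h) sp sq tp tr ,
  0≤half-inner s t (entry₁₂ a b c d e f g h) sp sq tq ts ,
  0≤half-inner s t (entry₂₁ a b c d e f g h) sr ss tp tr ,
  0≤half-inner s t (entry₂₂ a b c d e f g h) sr ss tq ts
  where
  entry₁₁ : ∀ a b c d e f g h →
    + 2 * ((a * e + b * g) + (a * f + b * h) + (c * e + d * g) + (c * f + d * h)) ≡
    (a + b + c + d) * (e + f + g + h) + ((b + d) - (a + c)) * ((g + h) - (e + f))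
  entry₁₁ = solve-∀
  entry₁₂ : ∀ a b c d e f g h →
    + 2 * (((a * f + b * h) + (c * f + d * h)) - ((a * e + b * g) + (c * e + d * g))) ≡
    (a + b + c + d) * ((f + h) - (e + g)) + ((b + d) - (a + c)) * ((e + h) - (f + g))
  entry₁₂ = solve-∀
  entry₂₁ : ∀ a b c d e f g h →
    + 2 * (((c * e + d * g) + (c * f + d * h)) - ((a * e + b * g) + (a * f + b * h))) ≡
    ((c + d) - (a + b)) * (e + f + g + h) + ((a + d) - (b + c)) * ((g + h) - (e + f))
  entry₂₁ = solve-∀
  entry₂₂ : ∀ a b c d e f g h →
    + 2 * (((a * e + b * g) + (c * f + d * h)) - ((a * f + b * h) + (c * e + d * g))) ≡
    ((c + d) - (a + b)) * ((f + h) - (e + g)) + ((a + d) - (b + c)) * ((e + h) - (f + g))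
  entry₂₂ = solve-∀

module _ (x y : ℤ) (Q : Mat2) where

  rot-row-sum : + 2 * ((x * b Q + y * d Q) + (x * a Q + y * c Q)) ≡
    (y + x) * a (rot Q) + (y - x) * c (rot Q)
  rot-row-sum = expand x y (a Q) (b Q) (c Q) (d Q)
    where
    expand : ∀ x y e f g h → + 2 * ((x * f + y * h) + (x * e + y * g)) ≡
      (y + x) * (e + f + g + h) + (y - x) * ((g + h) - (e + f))
    expand = solve-∀

  rot-row-difference : + 2 * ((x * b Q + y * d Q) - (x * a Q + y * c Q)) ≡
    (y + x) * b (rot Q) + (y - x) * d (rot Q)
  rot-row-difference = expand x y (a Q) (b Q) (c Q) (d Q)
    where
    expand : ∀ x y e f g h → + 2 * ((x * f + y * h) - (x * e + y * g)) ≡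
      (y + x) * ((f + h) - (e + g)) + (y - x) * ((e + h) - (f + g))
    expand = solve-∀

≼-row-⊗ : ∀ x y Q → x ≼ y → SameSign (rot Q) → (x * a Q + y * c Q) ≼ (x * b Q + y * d Q)
≼-row-⊗ x y Q (s , s-unit , su , sv) (t , t-unit , tp , tq , tr , ts) =
  s * t , isUnit-* s-unit t-unit ,
  0≤half-inner s t (rot-row-sum x y Q) su sv tp tr ,
  0≤half-inner s t (rot-row-difference x y Q) su sv tq ts

≼-col-⊗ : ∀ x y P → x ≼ y → SameSign (rot P) → (a P * x + b P * y) ≼ (c P * x + d P * y)
≼-col-⊗ x y (mat a b c d) (s , s-unit , su , sv) (t , t-unit , tp , tq , tr , ts) =
  t * s , isUnit-* t-unit s-unit ,
  0≤half-inner t s (sum x y a b c d) tp tq su sv ,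
  0≤half-inner t s (difference x y a b c d) tr ts su sv
  where
  sum : ∀ x y a b c d → + 2 * ((c * x + d * y) + (a * x + b * y)) ≡
    (a + b + c + d) * (y + x) + ((b + d) - (a + c)) * (y - x)
  sum = solve-∀
  difference : ∀ x y a b c d → + 2 * ((c * x + d * y) - (a * x + b * y)) ≡
    ((c + d) - (a + b)) * (y + x) + ((a + d) - (b + c)) * (y - x)
  difference = solve-∀

≼⇒∣x∣≤∣y∣ : ∀ x y → x ≼ y → ∣ x ∣ ≤ ∣ y ∣
≼⇒∣x∣≤∣y∣ x y (s , s-unit , 0≤U , 0≤V) = ℕ.*-cancelˡ-≤ 2 (begin
  2 ℕ.* ∣ x ∣            ≡⟨ cong (2 ℕ.*_) (sym (∣unit*x∣≡∣x∣ s-unit x)) ⟩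
  2 ℕ.* ∣ s * x ∣        ≡⟨ sym (ℤ.abs-* (+ 2) (s * x)) ⟩
  ∣ + 2 * (s * x) ∣      ≡⟨ cong ∣_∣ (difference s x y) ⟩
  ∣ U - V ∣              ≤⟨ ℤ.∣i-j∣≤∣i∣+∣j∣ U V ⟩
  ∣ U ∣ ℕ.+ ∣ V ∣        ≡⟨ sym (∣i+j∣≡∣i∣+∣j∣ 0≤U 0≤V) ⟩
  ∣ U + V ∣              ≡⟨ cong ∣_∣ (sym (sum s x y)) ⟩
  ∣ + 2 * (s * y) ∣      ≡⟨ ℤ.abs-* (+ 2) (s * y) ⟩
  2 ℕ.* ∣ s * y ∣        ≡⟨ cong (2 ℕ.*_) (∣unit*x∣≡∣x∣ s-unit y) ⟩
  2 ℕ.* ∣ y ∣            ∎)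
  where
  open ℕ.≤-Reasoning
  U = s * (y + x)
  V = s * (y - x)
  sum : ∀ s x y → + 2 * (s * y) ≡ s * (y + x) + s * (y - x)
  sum = solve-∀
  difference : ∀ s x y → + 2 * (s * x) ≡ s * (y + x) - s * (y - x)
  difference = solve-∀

∣x∣≤∣y∣⇒≼ : ∀ x y → ∣ x ∣ ≤ ∣ y ∣ → x ≼ y
∣x∣≤∣y∣⇒≼ x y ∣x∣≤∣y∣ with unit-normalizer y
... | s , s-unit , sy≡∣y∣ =
  s , s-unit , 0≤s[y+w] x ∣x∣≤∣y∣ , 0≤s[y+w] (- x) (subst (_≤ ∣ y ∣) (sym (ℤ.∣-i∣≡∣i∣ x)) ∣x∣≤∣y∣)
  where
  0≤s[y+w] : ∀ w → ∣ w ∣ ≤ ∣ y ∣ → 0ℤ ℤ.≤ s * (y + w)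
  0≤s[y+w] w ∣w∣≤∣y∣ = subst (0ℤ ℤ.≤_) (sym (*-distrib-normalized {s} {y} sy≡∣y∣ w))
    (0≤+n+w {s * w} (subst (_≤ ∣ y ∣) (sym (∣unit*x∣≡∣x∣ s-unit w)) ∣w∣≤∣y∣))

det : Mat2 → ℤ
det M = a M * d M - b M * c M

det-⊗ : ∀ P Q → det (P ⊗ Q) ≡ det P * det Q
det-⊗ (mat a b c d) (mat e f g h) = expand a b c d e f g h
  where
  expand : ∀ a b c d e f g h →
    (a * e + b * g) * (c * f + d * h) - (a * f + b * h) * (c * e + d * g) ≡
    (a * d - b * c) * (e * h - f * g)
  expand = solve-∀

det-Amat : ∀ e α → det (Amat e α) ≡ - e
det-Amat e α = expand e α
  where
  expand : ∀ e α → 0ℤ * α - e * 1ℤ ≡ - e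
  expand = solve-∀

isUnit-det-prodA : ∀ {n} (ε α : Fin n → ℤ) → (∀ i → IsUnit (ε i)) → ∀ w → IsUnit (det (prodA ε α w))
isUnit-det-prodA ε α ε-unit []      = inj₁ refl
isUnit-det-prodA ε α ε-unit (i ∷ w) =
  subst IsUnit (sym det≡) (isUnit-* (isUnit-neg (ε-unit i)) (isUnit-det-prodA ε α ε-unit w))
  where
  det≡ : det (prodA ε α (i ∷ w)) ≡ - ε i * det (prodA ε α w)
  det≡ = trans (det-⊗ (Amat (ε i) (α i)) (prodA ε α w)) (cong (_* det (prodA ε α w)) (det-Amat (ε i) (α i)))

-- If |x| = |y| then x divides x u − y w, so a unit value forces |x| = 1.
unit-cross⇒< : ∀ x u y w → IsUnit (x * u - y * w) → 2 ≤ ∣ y ∣ → ∣ x ∣ ≤ ∣ y ∣ → ∣ x ∣ < ∣ y ∣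
unit-cross⇒< x u y w unit 2≤∣y∣ ∣x∣≤∣y∣ = ℕ.≤∧≢⇒< ∣x∣≤∣y∣ λ ∣x∣≡∣y∣ →
  ℕ.<-irrefl refl (subst (2 ≤_) (trans (sym ∣x∣≡∣y∣) (∣x∣≡1 (∣x∣≡∣y∣⇒y≡x⊎y≡-x ∣x∣≡∣y∣))) 2≤∣y∣)
  where
  factor₁ : ∀ x u w → x * u - x * w ≡ x * (u - w)
  factor₁ = solve-∀
  factor₂ : ∀ x u w → x * u - (- x) * w ≡ x * (u + w)
  factor₂ = solve-∀
  ∣x∣≡1 : y ≡ x ⊎ y ≡ - x → ∣ x ∣ ≡ 1
  ∣x∣≡1 (inj₁ refl) = isUnit-*⇒∣x∣≡1 x (u - w) (subst IsUnit (factor₁ x u w) unit)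
  ∣x∣≡1 (inj₂ refl) = isUnit-*⇒∣x∣≡1 x (u + w) (subst IsUnit (factor₂ x u w) unit)

-det≡bc-da : ∀ a b c d → - (a * d - b * c) ≡ b * c - d * a
-det≡bc-da = solve-∀

-det≡cb-da : ∀ a b c d → - (a * d - b * c) ≡ c * b - d * a
-det≡cb-da = solve-∀

det≡ad-cb : ∀ a b c d → a * d - b * c ≡ a * d - c * b
det≡ad-cb = solve-∀

module _ (M : Mat2) (unit : IsUnit (det M)) where

  unit-det⇒∣b∣<∣d∣ : 2 ≤ ∣ d M ∣ → ∣ b M ∣ ≤ ∣ d M ∣ → ∣ b M ∣ < ∣ d M ∣
  unit-det⇒∣b∣<∣d∣ = unit-cross⇒< (b M) (c M) (d M) (a M)
    (subst IsUnit (-det≡bc-da (a M) (b M) (c M) (d M)) (isUnit-neg unit))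

  unit-det⇒∣c∣<∣d∣ : 2 ≤ ∣ d M ∣ → ∣ c M ∣ ≤ ∣ d M ∣ → ∣ c M ∣ < ∣ d M ∣
  unit-det⇒∣c∣<∣d∣ = unit-cross⇒< (c M) (b M) (d M) (a M)
    (subst IsUnit (-det≡cb-da (a M) (b M) (c M) (d M)) (isUnit-neg unit))

-- Each entry z of rot M satisfies d z = X Y ± det M with X, Y ∈ {d ± b, d ± c},
-- which have the sign of d because |b|, |c| < |d|.
sameSign-rot : ∀ M → IsUnit (det M) → ∣ b M ∣ < ∣ d M ∣ → ∣ c M ∣ < ∣ d M ∣ → SameSign (rot M)
sameSign-rot (mat a b c d) unit ∣b∣<∣d∣ ∣c∣<∣d∣ with unit-normalizer d
... | s , s-unit , sd≡∣d∣ = s , s-unit ,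
  0≤entry unit              (entry₁₁ a b c d) (1≤s[d+w] ∣b∣<∣d∣) (1≤s[d+w] ∣c∣<∣d∣) ,
  0≤entry (isUnit-neg unit) (entry₁₂ a b c d) (1≤s[d+w] ∣b∣<∣d∣) (1≤s[d-w] ∣c∣<∣d∣) ,
  0≤entry (isUnit-neg unit) (entry₂₁ a b c d) (1≤s[d-w] ∣b∣<∣d∣) (1≤s[d+w] ∣c∣<∣d∣) ,
  0≤entry unit              (entry₂₂ a b c d) (1≤s[d-w] ∣b∣<∣d∣) (1≤s[d-w] ∣c∣<∣d∣)
  where
  entry₁₁ : ∀ a b c d → d * (a + b + c + d) ≡ (d + b) * (d + c) + (a * d - b * c)
  entry₁₁ = solve-∀
  entry₁₂ : ∀ a b c d → d * ((b + d) - (a + c)) ≡ (d + b) * (d - c) + - (a * d - b * c)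
  entry₁₂ = solve-∀
  entry₂₁ : ∀ a b c d → d * ((c + d) - (a + b)) ≡ (d - b) * (d + c) + - (a * d - b * c)
  entry₂₁ = solve-∀
  entry₂₂ : ∀ a b c d → d * ((a + d) - (b + c)) ≡ (d - b) * (d - c) + (a * d - b * c)
  entry₂₂ = solve-∀
  1≤s[d+w] : ∣ w ∣ < ∣ d ∣ → 1ℤ ℤ.≤ s * (d + w)
  1≤s[d+w] {w} ∣w∣<∣d∣ = subst (1ℤ ℤ.≤_) (sym (*-distrib-normalized {s} {d} sd≡∣d∣ w))
    (1≤+n+w {s * w} (subst (_< ∣ d ∣) (sym (∣unit*x∣≡∣x∣ s-unit w)) ∣w∣<∣d∣))
  1≤s[d-w] : ∣ w ∣ < ∣ d ∣ → 1ℤ ℤ.≤ s * (d - w)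
  1≤s[d-w] {w} ∣w∣<∣d∣ = 1≤s[d+w] (subst (_< ∣ d ∣) (sym (ℤ.∣-i∣≡∣i∣ w)) ∣w∣<∣d∣)
  regroup : ∀ s x y → (s * x) * (s * y) ≡ (s * s) * (x * y)
  regroup = solve-∀
  0≤entry : ∀ {z X Y E} → IsUnit E → d * z ≡ X * Y + E →
    1ℤ ℤ.≤ s * X → 1ℤ ℤ.≤ s * Y → 0ℤ ℤ.≤ s * z
  0≤entry {z} {X} {Y} {E} E-unit dz≡XY+E 1≤sX 1≤sY =
    0≤n*z⇒0≤z (ℕ.≤-trans (s≤s z≤n) ∣b∣<∣d∣) (subst (0ℤ ℤ.≤_) (sym ∣d∣sz≡sXsY+E) (0≤u*v+unit 1≤sX 1≤sY E-unit))
    where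
    open ≡-Reasoning
    ∣d∣sz≡sXsY+E : + ∣ d ∣ * (s * z) ≡ (s * X) * (s * Y) + E
    ∣d∣sz≡sXsY+E = begin
      + ∣ d ∣ * (s * z)        ≡⟨ cong (_* (s * z)) (sym sd≡∣d∣) ⟩
      (s * d) * (s * z)        ≡⟨ regroup s d z ⟩
      (s * s) * (d * z)        ≡⟨ cong (_* (d * z)) (isUnit⇒s*s≡1 s-unit) ⟩
      1ℤ * (d * z)             ≡⟨ ℤ.*-identityˡ (d * z) ⟩
      d * z                    ≡⟨ dz≡XY+E ⟩
      X * Y + E                ≡⟨ cong (_+ E) (sym (ℤ.*-identityˡ (X * Y))) ⟩
      1ℤ * (X * Y) + E         ≡⟨ cong (λ k → k * (X * Y) + E) (sym (isUnit⇒s*s≡1 s-unit)) ⟩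
      (s * s) * (X * Y) + E    ≡⟨ cong (_+ E) (sym (regroup s X Y)) ⟩
      (s * X) * (s * Y) + E    ∎

gap : Mat2 → ℕ
gap M = ∣ d M ∣ ℕ.∸ ∣ c M ∣

module _ (P Q : Mat2) where

  ∣b∣≤∣b[P⊗Q]∣ : ∣ a P ∣ ≤ ∣ b P ∣ → ∣ b Q ∣ < ∣ d Q ∣ → ∣ b P ∣ ≤ ∣ b (P ⊗ Q) ∣
  ∣b∣≤∣b[P⊗Q]∣ ∣a∣≤∣b∣ ∣b∣<∣d∣ =
    ℕ.≤-trans (≤∧<⇒≤*∸* ∣a∣≤∣b∣ ∣b∣<∣d∣) (∣r∣∣s∣∸∣p∣∣q∣≤∣pq+rs∣ (a P) (b Q) (b P) (d Q))

  ∣c∣≤∣c[P⊗Q]∣ : ∣ a Q ∣ ≤ ∣ c Q ∣ → ∣ c P ∣ < ∣ d P ∣ → ∣ c Q ∣ ≤ ∣ c (P ⊗ Q) ∣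
  ∣c∣≤∣c[P⊗Q]∣ ∣a∣≤∣c∣ ∣c∣<∣d∣ = ℕ.≤-trans
    (subst₂ (λ m n → ∣ c Q ∣ ≤ m ℕ.∸ n) (ℕ.*-comm ∣ c Q ∣ ∣ d P ∣) (ℕ.*-comm ∣ a Q ∣ ∣ c P ∣)
      (≤∧<⇒≤*∸* ∣a∣≤∣c∣ ∣c∣<∣d∣))
    (∣r∣∣s∣∸∣p∣∣q∣≤∣pq+rs∣ (c P) (a Q) (d P) (c Q))

  ∣b∣≤∣a[P⊗Q]∣ : ∣ a P ∣ ≤ ∣ b P ∣ → ∣ a Q ∣ < ∣ c Q ∣ → ∣ b P ∣ ≤ ∣ a (P ⊗ Q) ∣
  ∣b∣≤∣a[P⊗Q]∣ ∣a∣≤∣b∣ ∣a∣<∣c∣ =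
    ℕ.≤-trans (≤∧<⇒≤*∸* ∣a∣≤∣b∣ ∣a∣<∣c∣) (∣r∣∣s∣∸∣p∣∣q∣≤∣pq+rs∣ (a P) (a Q) (b P) (c Q))

  ∣d∣+∣d∣≤1+∣d[P⊗Q]∣ : ∣ c P ∣ < ∣ d P ∣ → ∣ b Q ∣ < ∣ d Q ∣ → ∣ d P ∣ ℕ.+ ∣ d Q ∣ ≤ suc ∣ d (P ⊗ Q) ∣
  ∣d∣+∣d∣≤1+∣d[P⊗Q]∣ ∣c∣<∣d∣ ∣b∣<∣d∣ = ℕ.≤-trans (<∧<⇒+≤1+*∸* ∣c∣<∣d∣ ∣b∣<∣d∣)
    (s≤s (∣r∣∣s∣∸∣p∣∣q∣≤∣pq+rs∣ (c P) (b Q) (d P) (d Q)))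

  ∣b∣+∣d∣≤1+∣b[P⊗Q]∣ : ∣ a P ∣ < ∣ b P ∣ → ∣ b Q ∣ < ∣ d Q ∣ → ∣ b P ∣ ℕ.+ ∣ d Q ∣ ≤ suc ∣ b (P ⊗ Q) ∣
  ∣b∣+∣d∣≤1+∣b[P⊗Q]∣ ∣a∣<∣b∣ ∣b∣<∣d∣ = ℕ.≤-trans (<∧<⇒+≤1+*∸* ∣a∣<∣b∣ ∣b∣<∣d∣)
    (s≤s (∣r∣∣s∣∸∣p∣∣q∣≤∣pq+rs∣ (a P) (b Q) (b P) (d Q)))

  ∣d∣∸1≤∣b[P⊗Q]∣ : ∣ b P ∣ ≡ 1 → ∣ a P ∣ ≤ 1 → ∣ b Q ∣ ≤ 1 → ∣ d Q ∣ ℕ.∸ 1 ≤ ∣ b (P ⊗ Q) ∣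
  ∣d∣∸1≤∣b[P⊗Q]∣ ∣b∣≡1 ∣a∣≤1 ∣b∣≤1 = ℕ.≤-trans
    (ℕ.∸-mono (ℕ.≤-reflexive (sym (trans (cong (ℕ._* ∣ d Q ∣) ∣b∣≡1) (ℕ.*-identityˡ ∣ d Q ∣))))
              (ℕ.*-mono-≤ ∣a∣≤1 ∣b∣≤1))
    (∣r∣∣s∣∸∣p∣∣q∣≤∣pq+rs∣ (a P) (b Q) (b P) (d Q))

  gap≤∣c[P⊗Q]∣ : ∣ c Q ∣ ≡ 1 → ∣ a Q ∣ ≤ 1 → gap P ≤ ∣ c (P ⊗ Q) ∣
  gap≤∣c[P⊗Q]∣ ∣c∣≡1 ∣a∣≤1 = ℕ.≤-trans
    (ℕ.∸-mono (ℕ.≤-reflexive (sym (trans (cong (∣ d P ∣ ℕ.*_) ∣c∣≡1) (ℕ.*-identityʳ ∣ d P ∣))))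
              (ℕ.≤-trans (ℕ.*-monoʳ-≤ ∣ c P ∣ ∣a∣≤1) (ℕ.≤-reflexive (ℕ.*-identityʳ ∣ c P ∣))))
    (∣r∣∣s∣∸∣p∣∣q∣≤∣pq+rs∣ (c P) (a Q) (d P) (c Q))

record Admissible (M : Mat2) : Set where
  field
    det-unit     : IsUnit (det M)
    rot-sameSign : SameSign (rot M)
    ∣a∣≤∣b∣      : ∣ a M ∣ ≤ ∣ b M ∣
    ∣c∣≤∣d∣      : ∣ c M ∣ ≤ ∣ d M ∣
    ∣a∣≤∣c∣      : ∣ a M ∣ ≤ ∣ c M ∣
    ∣b∣≤∣d∣      : ∣ b M ∣ ≤ ∣ d M ∣
    2≤∣d∣        : 2 ≤ ∣ d M ∣
    1≤∣b∣        : 1 ≤ ∣ b M ∣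
    1≤∣c∣        : 1 ≤ ∣ c M ∣

  ∣b∣<∣d∣ : ∣ b M ∣ < ∣ d M ∣
  ∣b∣<∣d∣ = unit-det⇒∣b∣<∣d∣ M det-unit 2≤∣d∣ ∣b∣≤∣d∣

  ∣c∣<∣d∣ : ∣ c M ∣ < ∣ d M ∣
  ∣c∣<∣d∣ = unit-det⇒∣c∣<∣d∣ M det-unit 2≤∣d∣ ∣c∣≤∣d∣

  2≤∣b∣⇒∣a∣<∣b∣ : 2 ≤ ∣ b M ∣ → ∣ a M ∣ < ∣ b M ∣
  2≤∣b∣⇒∣a∣<∣b∣ 2≤∣b∣ = unit-cross⇒< (a M) (d M) (b M) (c M) det-unit 2≤∣b∣ ∣a∣≤∣b∣

  2≤∣c∣⇒∣a∣<∣c∣ : 2 ≤ ∣ c M ∣ → ∣ a M ∣ < ∣ c M ∣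
  2≤∣c∣⇒∣a∣<∣c∣ 2≤∣c∣ = unit-cross⇒< (a M) (d M) (c M) (b M)
    (subst IsUnit (det≡ad-cb (a M) (b M) (c M) (d M)) det-unit) 2≤∣c∣ ∣a∣≤∣c∣

open Admissible

Conditions : Mat2 → Set
Conditions M = (2 ≤ ∣ d M ∣) × (b M ≢ 0ℤ) × (c M ≢ 0ℤ) ×
  (∣ a M ∣ ≤ ∣ b M ∣) × (∣ c M ∣ ≤ ∣ d M ∣) × (∣ a M ∣ ≤ ∣ c M ∣) × (∣ b M ∣ ≤ ∣ d M ∣)

x≢0⇒1≤∣x∣ : x ≢ 0ℤ → 1 ≤ ∣ x ∣
x≢0⇒1≤∣x∣ x≢0 = ℕ.n≢0⇒n>0 (λ ∣x∣≡0 → x≢0 (ℤ.∣i∣≡0⇒i≡0 ∣x∣≡0))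

conditions⇒admissible : ∀ M → IsUnit (det M) → Conditions M → Admissible M
conditions⇒admissible M unit (2≤∣d∣ , b≢0 , c≢0 , ∣a∣≤∣b∣ , ∣c∣≤∣d∣ , ∣a∣≤∣c∣ , ∣b∣≤∣d∣) = record
  { det-unit     = unit
  ; rot-sameSign = sameSign-rot M unit
                     (unit-det⇒∣b∣<∣d∣ M unit 2≤∣d∣ ∣b∣≤∣d∣) (unit-det⇒∣c∣<∣d∣ M unit 2≤∣d∣ ∣c∣≤∣d∣)
  ; ∣a∣≤∣b∣      = ∣a∣≤∣b∣
  ; ∣c∣≤∣d∣      = ∣c∣≤∣d∣
  ; ∣a∣≤∣c∣      = ∣a∣≤∣c∣
  ; ∣b∣≤∣d∣      = ∣b∣≤∣d∣
  ; 2≤∣d∣        = 2≤∣d∣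
  ; 1≤∣b∣        = x≢0⇒1≤∣x∣ b≢0
  ; 1≤∣c∣        = x≢0⇒1≤∣x∣ c≢0
  }

∣d∣<∣d[P⊗Q]∣ : Admissible P → Admissible Q → ∣ d Q ∣ < ∣ d (P ⊗ Q) ∣
∣d∣<∣d[P⊗Q]∣ {P} {Q} adm-P adm-Q =
  +≤1+⇒< (2≤∣d∣ adm-P) (∣d∣+∣d∣≤1+∣d[P⊗Q]∣ P Q (∣c∣<∣d∣ adm-P) (∣b∣<∣d∣ adm-Q))

admissible-⊗ : Admissible P → Admissible Q → Admissible (P ⊗ Q)
admissible-⊗ {P} {Q} adm-P adm-Q = record
  { det-unit     = subst IsUnit (sym (det-⊗ P Q)) (isUnit-* (det-unit adm-P) (det-unit adm-Q))
  ; rot-sameSign = sameSign-rot-⊗ P Q (rot-sameSign adm-P) (rot-sameSign adm-Q)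
  ; ∣a∣≤∣b∣      = row (a P) (b P) (∣a∣≤∣b∣ adm-P)
  ; ∣c∣≤∣d∣      = row (c P) (d P) (∣c∣≤∣d∣ adm-P)
  ; ∣a∣≤∣c∣      = column (a Q) (c Q) (∣a∣≤∣c∣ adm-Q)
  ; ∣b∣≤∣d∣      = column (b Q) (d Q) (∣b∣≤∣d∣ adm-Q)
  ; 2≤∣d∣        = ℕ.≤-trans (2≤∣d∣ adm-Q) (ℕ.<⇒≤ (∣d∣<∣d[P⊗Q]∣ adm-P adm-Q))
  ; 1≤∣b∣        = ℕ.≤-trans (1≤∣b∣ adm-P) (∣b∣≤∣b[P⊗Q]∣ P Q (∣a∣≤∣b∣ adm-P) (∣b∣<∣d∣ adm-Q))
  ; 1≤∣c∣        = ℕ.≤-trans (1≤∣c∣ adm-Q) (∣c∣≤∣c[P⊗Q]∣ P Q (∣a∣≤∣c∣ adm-Q) (∣c∣<∣d∣ adm-P))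
  }
  where
  row : ∀ x y → ∣ x ∣ ≤ ∣ y ∣ → ∣ x * a Q + y * c Q ∣ ≤ ∣ x * b Q + y * d Q ∣
  row x y ∣x∣≤∣y∣ = ≼⇒∣x∣≤∣y∣ (x * a Q + y * c Q) (x * b Q + y * d Q)
    (≼-row-⊗ x y Q (∣x∣≤∣y∣⇒≼ x y ∣x∣≤∣y∣) (rot-sameSign adm-Q))
  column : ∀ x y → ∣ x ∣ ≤ ∣ y ∣ → ∣ a P * x + b P * y ∣ ≤ ∣ c P * x + d P * y ∣
  column x y ∣x∣≤∣y∣ = ≼⇒∣x∣≤∣y∣ (a P * x + b P * y) (c P * x + d P * y)
    (≼-col-⊗ x y P (∣x∣≤∣y∣⇒≼ x y ∣x∣≤∣y∣) (rot-sameSign adm-P))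

x*1+y*0≡x : ∀ x y → x * 1ℤ + y * 0ℤ ≡ x
x*1+y*0≡x = solve-∀

x*0+y*1≡y : ∀ x y → x * 0ℤ + y * 1ℤ ≡ y
x*0+y*1≡y = solve-∀

⊗-identityʳ : ∀ M → M ⊗ I₂ ≡ M
⊗-identityʳ (mat a b c d)
  rewrite x*1+y*0≡x a b | x*0+y*1≡y a b | x*1+y*0≡x c d | x*0+y*1≡y c d = refl

admissible-^ᴹ : ∀ {n} → 1 ≤ n → Admissible P → Admissible (P ^ᴹ n)
admissible-^ᴹ {P} {suc zero}    _ adm = subst Admissible (sym (⊗-identityʳ P)) adm
admissible-^ᴹ {P} {suc (suc n)} _ adm = admissible-⊗ adm (admissible-^ᴹ {n = suc n} (s≤s z≤n) adm)

LeftMonotone : (Mat2 → ℕ) → Set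
LeftMonotone f = ∀ {P Q} → Admissible P → Admissible Q → f P ≤ f (P ⊗ Q)

leftMonotone-^ᴹ : ∀ {f} → LeftMonotone f → ∀ {n} → 1 ≤ n → Admissible P → f P ≤ f (P ^ᴹ n)
leftMonotone-^ᴹ {P} {f} _    {suc zero}    _ _   = ℕ.≤-reflexive (cong f (sym (⊗-identityʳ P)))
leftMonotone-^ᴹ {P} mono {suc (suc n)} _ adm = mono adm (admissible-^ᴹ {n = suc n} (s≤s z≤n) adm)

module _ (M : Mat2) (∣c∣<∣d∣ : ∣ c M ∣ < ∣ d M ∣) where

  2≤∣2w∣ : ∀ w → ∣ d M ∣ ℕ.∸ ∣ c M ∣ ≤ ∣ w ∣ → 2 ≤ ∣ + 2 * w ∣
  2≤∣2w∣ w gap≤∣w∣ = subst (2 ≤_) (sym (ℤ.abs-* (+ 2) w))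
    (ℕ.*-monoʳ-≤ 2 (ℕ.≤-trans (ℕ.m+n≤o⇒m≤o∸n 1 ∣c∣<∣d∣) gap≤∣w∣))

  2≤∣a+c∣-rot : 2 ≤ ∣ a (rot M) + c (rot M) ∣
  2≤∣a+c∣-rot = subst (λ k → 2 ≤ ∣ k ∣) (sym (collect (a M) (b M) (c M) (d M)))
    (2≤∣2w∣ (d M + c M) (∣y∣∸∣x∣≤∣y+x∣ (c M) (d M)))
    where
    collect : ∀ a b c d → (a + b + c + d) + ((c + d) - (a + b)) ≡ + 2 * (d + c)
    collect = solve-∀

  2≤∣b+d∣-rot : 2 ≤ ∣ b (rot M) + d (rot M) ∣
  2≤∣b+d∣-rot = subst (λ k → 2 ≤ ∣ k ∣) (sym (collect (a M) (b M) (c M) (d M)))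
    (2≤∣2w∣ (d M - c M) (∣y∣∸∣x∣≤∣y-x∣ (c M) (d M)))
    where
    collect : ∀ a b c d → ((b + d) - (a + c)) + ((a + d) - (b + c)) ≡ + 2 * (d - c)
    collect = solve-∀

-- gap M is the smaller absolute value in the rotated second row (d + c , d − c) of M. For P ⊗ Q
-- that row is half the one of P times rot Q, whose column sums are at least 2 in absolute value.
gap-left : LeftMonotone gap
gap-left {P} {Q} adm-P adm-Q with ∣x∣≤∣y∣⇒≼ (c P) (d P) (∣c∣≤∣d∣ adm-P) | rot-sameSign adm-Q
... | s , s-unit , su , sv | t , t-unit , tp , tq , tr , ts = begin
  gap P                                   ≤⟨ ∸≤⊓ (c P) (d P) ⟩
  ∣ d P + c P ∣ ℕ.⊓ ∣ d P - c P ∣         ≤⟨ ℕ.⊓-glb ≤∣d′+c′∣ ≤∣d′-c′∣ ⟩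
  ∣ d′ + c′ ∣ ℕ.⊓ ∣ d′ - c′ ∣             ≤⟨ ⊓≤∸ c′ d′ (∣c∣≤∣d∣ (admissible-⊗ adm-P adm-Q)) ⟩
  gap (P ⊗ Q)                             ∎
  where
  open ℕ.≤-Reasoning
  c′ = c (P ⊗ Q)
  d′ = d (P ⊗ Q)
  ≤∣d′+c′∣ : ∣ d P + c P ∣ ℕ.⊓ ∣ d P - c P ∣ ≤ ∣ d′ + c′ ∣
  ≤∣d′+c′∣ = ⊓≤∣half-inner∣ s t s-unit t-unit (rot-row-sum (c P) (d P) Q) su sv tp tr
    (2≤∣a+c∣-rot Q (∣c∣<∣d∣ adm-Q))
  ≤∣d′-c′∣ : ∣ d P + c P ∣ ℕ.⊓ ∣ d P - c P ∣ ≤ ∣ d′ - c′ ∣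
  ≤∣d′-c′∣ = ⊓≤∣half-inner∣ s t s-unit t-unit (rot-row-difference (c P) (d P) Q) su sv tq ts
    (2≤∣b+d∣-rot Q (∣c∣<∣d∣ adm-Q))

∣b∣-left : LeftMonotone (λ M → ∣ b M ∣)
∣b∣-left {P} {Q} adm-P adm-Q = ∣b∣≤∣b[P⊗Q]∣ P Q (∣a∣≤∣b∣ adm-P) (∣b∣<∣d∣ adm-Q)

∣b∣<∣b[P⊗Q]∣ : Admissible P → Admissible Q → 2 ≤ ∣ b P ∣ → ∣ b P ∣ < ∣ b (P ⊗ Q) ∣
∣b∣<∣b[P⊗Q]∣ {P} {Q} adm-P adm-Q 2≤∣b∣ = +≤1+⇒< (2≤∣d∣ adm-Q)
  (subst (_≤ suc ∣ b (P ⊗ Q) ∣) (ℕ.+-comm ∣ b P ∣ ∣ d Q ∣)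
    (∣b∣+∣d∣≤1+∣b[P⊗Q]∣ P Q (2≤∣b∣⇒∣a∣<∣b∣ adm-P 2≤∣b∣) (∣b∣<∣d∣ adm-Q)))

Large : ℕ → Mat2 → Set
Large N M = (N ≤ ∣ a M ∣) × (N ≤ ∣ b M ∣) × (N ≤ ∣ c M ∣) × (N ≤ ∣ d M ∣)

N≤∣a∣⇒Large : ∀ {N} → Admissible P → N ≤ ∣ a P ∣ → Large N P
N≤∣a∣⇒Large adm N≤∣a∣ = N≤∣a∣ , N≤∣b∣ , ℕ.≤-trans N≤∣a∣ (∣a∣≤∣c∣ adm) , ℕ.≤-trans N≤∣b∣ (∣b∣≤∣d∣ adm)
  where N≤∣b∣ = ℕ.≤-trans N≤∣a∣ (∣a∣≤∣b∣ adm)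

module Recurrence (P₁ P₂ : Mat2) (q : ℕ → ℕ) (q-pos : ∀ m → 1 ≤ m → 1 ≤ q m)
                  (adm₁ : Admissible P₁) (adm₂ : Admissible P₂) where

  Pₘ : ℕ → Mat2
  Pₘ = Pseq P₁ P₂ q

  -- Pₘ (3 ℕ.+ m) reduces to X m ⊗ Pₘ (1 ℕ.+ m).
  X : ℕ → Mat2
  X m = Pₘ (2 ℕ.+ m) ^ᴹ q (1 ℕ.+ m)

  1≤q : ∀ m → 1 ≤ q (1 ℕ.+ m)
  1≤q m = q-pos (1 ℕ.+ m) (s≤s z≤n)

  admissible-pair : ∀ m → Admissible (Pₘ (1 ℕ.+ m)) × Admissible (Pₘ (2 ℕ.+ m))
  admissible-pair zero    = adm₁ , adm₂
  admissible-pair (suc m) with admissible-pair m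
  ... | adm , adm′ = adm′ , admissible-⊗ (admissible-^ᴹ (1≤q m) adm′) adm

  admissible-P : ∀ m → Admissible (Pₘ (1 ℕ.+ m))
  admissible-P m = proj₁ (admissible-pair m)

  admissible-X : ∀ m → Admissible (X m)
  admissible-X m = admissible-^ᴹ (1≤q m) (admissible-P (1 ℕ.+ m))

  module _ {f : Mat2 → ℕ} (mono : LeftMonotone f) (m : ℕ) where

    ≤-X : f (Pₘ (2 ℕ.+ m)) ≤ f (X m)
    ≤-X = leftMonotone-^ᴹ mono (1≤q m) (admissible-P (1 ℕ.+ m))

    ≤-next : f (Pₘ (2 ℕ.+ m)) ≤ f (Pₘ (3 ℕ.+ m))
    ≤-next = ℕ.≤-trans ≤-X (mono (admissible-X m) (admissible-P m))

  3≤∣d∣ : ∀ m → 3 ≤ ∣ d (Pₘ (3 ℕ.+ m)) ∣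
  3≤∣d∣ m = ℕ.≤-trans (s≤s (2≤∣d∣ (admissible-P m))) (∣d∣<∣d[P⊗Q]∣ (admissible-X m) (admissible-P m))

  3≤∣d∣⇒2≤∣b∣ : ∀ m → 3 ≤ ∣ d (Pₘ (2 ℕ.+ m)) ∣ → 2 ≤ ∣ b (Pₘ (4 ℕ.+ m)) ∣
  3≤∣d∣⇒2≤∣b∣ m 3≤∣d∣ with 1≤n⇒n≡1⊎2≤n (1≤∣b∣ (admissible-X (1 ℕ.+ m)))
  ... | inj₂ 2≤∣b[X]∣ = ℕ.≤-trans 2≤∣b[X]∣ (∣b∣-left (admissible-X (1 ℕ.+ m)) (admissible-P (1 ℕ.+ m)))
  ... | inj₁ ∣b[X]∣≡1 = ℕ.≤-trans (ℕ.∸-monoˡ-≤ 1 3≤∣d∣)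
    (∣d∣∸1≤∣b[P⊗Q]∣ (X (1 ℕ.+ m)) (Pₘ (2 ℕ.+ m)) ∣b[X]∣≡1
      (subst (∣ a (X (1 ℕ.+ m)) ∣ ≤_) ∣b[X]∣≡1 (∣a∣≤∣b∣ (admissible-X (1 ℕ.+ m))))
      (subst (∣ b (Pₘ (2 ℕ.+ m)) ∣ ≤_) ∣b[X]∣≡1 (ℕ.≤-trans (≤-next ∣b∣-left m) (≤-X ∣b∣-left (1 ℕ.+ m)))))

  -- When |c P| = 1 the bound |c (X ⊗ P)| ≥ |c P| is useless; instead
  -- |c (X ⊗ P)| ≥ gap X ≥ gap P = |d P| − 1.
  3≤∣d∣⇒2≤∣c∣ : ∀ m → 3 ≤ ∣ d (Pₘ (2 ℕ.+ m)) ∣ → 2 ≤ ∣ c (Pₘ (4 ℕ.+ m)) ∣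
  3≤∣d∣⇒2≤∣c∣ m 3≤∣d∣ with 1≤n⇒n≡1⊎2≤n (1≤∣c∣ (admissible-P (1 ℕ.+ m)))
  ... | inj₂ 2≤∣c∣ = ℕ.≤-trans 2≤∣c∣
    (∣c∣≤∣c[P⊗Q]∣ (X (1 ℕ.+ m)) (Pₘ (2 ℕ.+ m))
      (∣a∣≤∣c∣ (admissible-P (1 ℕ.+ m))) (∣c∣<∣d∣ (admissible-X (1 ℕ.+ m))))
  ... | inj₁ ∣c∣≡1 = begin
    2                          ≤⟨ ℕ.∸-monoˡ-≤ 1 3≤∣d∣ ⟩
    ∣ d (Pₘ (2 ℕ.+ m)) ∣ ℕ.∸ 1 ≡⟨ cong (∣ d (Pₘ (2 ℕ.+ m)) ∣ ℕ.∸_) (sym ∣c∣≡1) ⟩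
    gap (Pₘ (2 ℕ.+ m))         ≤⟨ ≤-next gap-left m ⟩
    gap (Pₘ (3 ℕ.+ m))         ≤⟨ ≤-X gap-left (1 ℕ.+ m) ⟩
    gap (X (1 ℕ.+ m))          ≤⟨ gap≤∣c[P⊗Q]∣ (X (1 ℕ.+ m)) (Pₘ (2 ℕ.+ m)) ∣c∣≡1
                                    (subst (∣ a (Pₘ (2 ℕ.+ m)) ∣ ≤_) ∣c∣≡1 (∣a∣≤∣c∣ (admissible-P (1 ℕ.+ m)))) ⟩
    ∣ c (Pₘ (4 ℕ.+ m)) ∣       ∎
    where
    open ℕ.≤-Reasoning

  2+j≤∣b∣ : ∀ j → 2 ℕ.+ j ≤ ∣ b (Pₘ (5 ℕ.+ j)) ∣
  2+j≤∣b∣ zero    = 3≤∣d∣⇒2≤∣b∣ 1 (3≤∣d∣ 0)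
  2+j≤∣b∣ (suc j) = begin-strict
    2 ℕ.+ j                ≤⟨ 2+j≤∣b∣ j ⟩
    ∣ b (Pₘ (5 ℕ.+ j)) ∣   ≤⟨ ≤-X ∣b∣-left (3 ℕ.+ j) ⟩
    ∣ b (X (3 ℕ.+ j)) ∣    <⟨ ∣b∣<∣b[P⊗Q]∣ (admissible-X (3 ℕ.+ j)) (admissible-P (3 ℕ.+ j))
                               (ℕ.≤-trans (3≤∣d∣⇒2≤∣b∣ (1 ℕ.+ j) (3≤∣d∣ j)) (≤-X ∣b∣-left (3 ℕ.+ j))) ⟩
    ∣ b (Pₘ (6 ℕ.+ j)) ∣   ∎
    where open ℕ.≤-Reasoning

  j≤∣a∣ : ∀ j → j ≤ ∣ a (Pₘ (7 ℕ.+ j)) ∣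
  j≤∣a∣ j = begin
    j                      ≤⟨ ℕ.m≤n+m j 3 ⟩
    3 ℕ.+ j                ≤⟨ 2+j≤∣b∣ (suc j) ⟩
    ∣ b (Pₘ (6 ℕ.+ j)) ∣   ≤⟨ ≤-X ∣b∣-left (4 ℕ.+ j) ⟩
    ∣ b (X (4 ℕ.+ j)) ∣    ≤⟨ ∣b∣≤∣a[P⊗Q]∣ (X (4 ℕ.+ j)) (Pₘ (5 ℕ.+ j)) (∣a∣≤∣b∣ (admissible-X (4 ℕ.+ j)))
                               (2≤∣c∣⇒∣a∣<∣c∣ (admissible-P (4 ℕ.+ j)) (3≤∣d∣⇒2≤∣c∣ (1 ℕ.+ j) (3≤∣d∣ j))) ⟩
    ∣ a (Pₘ (7 ℕ.+ j)) ∣   ∎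
    where open ℕ.≤-Reasoning

  eventually-large : ∀ N → ∃[ M ] ∀ m → M ≤ m → Large N (Pₘ m)
  eventually-large N = 7 ℕ.+ N , large-from
    where
    large-from : ∀ m → 7 ℕ.+ N ≤ m → Large N (Pₘ m)
    large-from m 7+N≤m with ℕ.m≤n⇒∃[o]m+o≡n 7+N≤m
    ... | k , refl = N≤∣a∣⇒Large (admissible-P (6 ℕ.+ N ℕ.+ k)) (ℕ.≤-trans (ℕ.m≤m+n N k) (j≤∣a∣ (N ℕ.+ k)))

lemma2p5 : (v : ℕ) → 1 ≤ v →
    (ε α : Fin v → ℤ) → (∀ i → ε i ≡ 1ℤ ⊎ ε i ≡ -1ℤ) →
    (P1 P2 : Mat2) →
    (∃[ w ] prodA ε α w ≡ P1) → (∃[ w ] prodA ε α w ≡ P2) →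
    (∀ P → P ≡ P1 ⊎ P ≡ P2 →
        (2 ≤ ∣ d P ∣) × (b P ≢ 0ℤ) × (c P ≢ 0ℤ) ×
        (∣ a P ∣ ≤ ∣ b P ∣) × (∣ c P ∣ ≤ ∣ d P ∣) ×
        (∣ a P ∣ ≤ ∣ c P ∣) × (∣ b P ∣ ≤ ∣ d P ∣)) →
    (q : ℕ → ℕ) → (∀ m → 1 ≤ m → 1 ≤ q m) →
    ∀ (N : ℕ) → ∃[ M ] ∀ m → M ≤ m →
      (N ≤ ∣ a (Pseq P1 P2 q m) ∣) × (N ≤ ∣ b (Pseq P1 P2 q m) ∣) ×
      (N ≤ ∣ c (Pseq P1 P2 q m) ∣) × (N ≤ ∣ d (Pseq P1 P2 q m) ∣)
lemma2p5 _ _ ε α ε-unit P1 P2 (w₁ , w₁≡P1) (w₂ , w₂≡P2) conditions q q-pos =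
  Recurrence.eventually-large P1 P2 q q-pos
    (admissible-word w₁ w₁≡P1 (inj₁ refl)) (admissible-word w₂ w₂≡P2 (inj₂ refl))
  where
  admissible-word : ∀ {P} w → prodA ε α w ≡ P → P ≡ P1 ⊎ P ≡ P2 → Admissible P
  admissible-word {P} w refl P∈ = conditions⇒admissible P (isUnit-det-prodA ε α ε-unit w) (conditions P P∈)
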